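{- Let $k\geq1$ and let $G=([n],E)$ be a $k$-connected PEO graph. Then for every $\nu=2,\ldots,n$, the subgraph $G^{[\nu]}$ is $\min\{\nu-1,k\}$-connected.
   Context: $G=([n],E)$ is a PEO graph if for every vertex $v$, $v$ together with its neighbors smaller than $v$ forms a clique. $G^{[\nu]}$ is the subgraph induced by the vertices $1,\ldots,\nu$. For an integer $k\geq1$, a graph is $k$-connected if it has at least $k+1$ vertices and removing any set of $k-1$ vertices leaves a connected graph. -}

module Defs where

open import Level using (0ℓ)
open import Data.Nat using (ℕ; _≤_; _<_; _∸_; suc)
open import Data.Product using (_×_)
open import Data.List using (List; length)
open import Data.List.Relation.Unary.All using (All)
open import Data.List.Relation.Unary.Unique.Propositional using (Unique)
open import Data.List.Membership.Propositional using (_∉_)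
open import Relation.Binary.PropositionalEquality using (_≡_; _≢_)
open import Relation.Nullary using (¬_)

-- A simple (undirected, loopless) graph whose vertices are natural numbers;
-- the graph G = ([n], E) uses the vertices 1, ..., n.
record Graph : Set₁ where
  field
    Adj     : ℕ → ℕ → Set
    symm    : ∀ {u v} → Adj u v → Adj v u
    irrefl  : ∀ {u} → ¬ Adj u u
open Graph public

InRange : ℕ → ℕ → Set
InRange ν v = 1 ≤ v × v ≤ ν

IsPEO : Graph → ℕ → Set
IsPEO G n = ∀ v a b → InRange n v → a < v → b < v →
            Adj G v a → Adj G v b → a ≢ b → Adj G a b

data Reach (G : Graph) (S : ℕ → Set) : ℕ → ℕ → Set where
  here : ∀ {u} → Reach G S u u
  step : ∀ {u w v} → Adj G u w → S w → Reach G S w v → Reach G S u v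

Connected : Graph → (ℕ → Set) → Set
Connected G S = ∀ u v → S u → S v → Reach G S u v

KConnected : Graph → ℕ → ℕ → Set
KConnected G ν k =
  suc k ≤ ν ×
  (∀ (X : List ℕ) → Unique X → length X ≡ k ∸ 1 → All (InRange ν) X →
     Connected G (λ v → InRange ν v × v ∉ X))

{-# OPTIONS --safe #-}
module Submission where

-- Extend a removed set X ⊆ [ν] of fewer than k vertices, avoiding the two endpoints u and v,
-- to a set Y ⊆ [n] of exactly k − 1 vertices.  By k-connectivity of G, u and v are joined by
-- a walk in G[n] − Y, hence in G[n] − X.  Such a walk can be pulled down into [ν]: whenever
-- it passes through the largest vertex μ + 1 in use, the two neighbours of μ + 1 on the walk
-- are smaller than μ + 1, so by the perfect elimination ordering they coincide or are adjacent,
-- and μ + 1 can be skipped.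

open import Defs
open import Data.Nat using (ℕ; zero; suc; _+_; _∸_; _⊓_; _≤_; _<_; z≤n; s≤s; _≟_; _≤?_)
open import Data.Nat.Properties
open import Data.Product using (_×_; _,_; proj₁; proj₂; ∃-syntax)
open import Data.List using (List; []; _∷_; _++_; length; filter)
open import Data.List.Properties using (length-++; filter-notAll)
open import Data.List.Relation.Unary.All as All using (All; _∷_)
open import Data.List.Relation.Unary.All.Properties using (¬Any⇒All¬)
open import Data.List.Relation.Unary.Any as Any using (here; there)
open import Data.List.Relation.Unary.AllPairs using (_∷_)
open import Data.List.Relation.Unary.Unique.Propositional using (Unique)
open import Data.List.Relation.Binary.Disjoint.Propositional using (Disjoint)
open import Data.List.Relation.Binary.Subset.Propositional using (_⊆_)
open import Data.List.Membership.Propositional using (_∈_; _∉_)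
open import Data.List.Membership.Propositional.Properties using (∈-++⁺ˡ; ∈-++⁺ʳ; ∈-filter⁺)
open import Data.List.Membership.DecPropositional _≟_ using (_∈?_)
open import Data.Empty using (⊥-elim)
open import Relation.Nullary using (¬_; yes; no; ¬?)
open import Relation.Binary.PropositionalEquality using (_≡_; refl; sym; trans; subst)

fresh : ∀ n (L : List ℕ) → length L < n → ∃[ w ] InRange n w × w ∉ L
fresh (suc n) L |L|≤n with suc n ∈? L
... | no n+1∉L = suc n , (s≤s z≤n , ≤-refl) , n+1∉L
... | yes n+1∈L with fresh n L′ (≤-trans shorter (≤-pred |L|≤n))
  where
  L′ : List ℕ
  L′ = filter (λ x → ¬? (x ≟ suc n)) L
  shorter : length L′ < length L
  shorter = filter-notAll _ L (Any.map (λ eq ne → ne (sym eq)) n+1∈L)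
... | w , (1≤w , w≤n) , w∉L′ =
  w , (1≤w , m≤n⇒m≤1+n w≤n) ,
  λ w∈L → w∉L′ (∈-filter⁺ (λ x → ¬? (x ≟ suc n)) w∈L (λ { refl → 1+n≰n w≤n }))

module _ {n : ℕ} (F : List ℕ) where

  extend-by : ∀ j (X : List ℕ) → Unique X → All (InRange n) X → Disjoint F X →
              length F + (length X + j) ≤ n →
              ∃[ Y ] Unique Y × All (InRange n) Y × Disjoint F Y × X ⊆ Y × length Y ≡ length X + j
  extend-by zero X uX X⊆[n] F#X _ = X , uX , X⊆[n] , F#X , (λ x∈X → x∈X) , sym (+-identityʳ _)
  extend-by (suc j) X uX X⊆[n] F#X bound
    with fresh n (F ++ X) room
    where
    room : length (F ++ X) < n
    room = begin-strict
      length (F ++ X)                   ≡⟨ length-++ F ⟩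
      length F + length X               <⟨ +-monoʳ-< (length F) (m<m+n (length X) (s≤s z≤n)) ⟩
      length F + (length X + suc j)     ≤⟨ bound ⟩
      n                                 ∎
      where open ≤-Reasoning
  ... | w , w∈[n] , w∉F++X
    with extend-by j (w ∷ X) (¬Any⇒All¬ X (λ w∈X → w∉F++X (∈-++⁺ʳ F w∈X)) ∷ uX) (w∈[n] ∷ X⊆[n])
           F#wX (subst (λ t → length F + t ≤ n) (+-suc (length X) j) bound)
    where
    F#wX : Disjoint F (w ∷ X)
    F#wX (x∈F , here refl)  = w∉F++X (∈-++⁺ˡ x∈F)
    F#wX (x∈F , there x∈X) = F#X (x∈F , x∈X)
  ... | Y , uY , Y⊆[n] , F#Y , wX⊆Y , |Y| =
    Y , uY , Y⊆[n] , F#Y , (λ x∈X → wX⊆Y (there x∈X)) , trans |Y| (sym (+-suc (length X) j))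

  extend-to : ∀ m (X : List ℕ) → Unique X → All (InRange n) X → Disjoint F X →
              length X ≤ m → length F + m ≤ n →
              ∃[ Y ] Unique Y × All (InRange n) Y × Disjoint F Y × X ⊆ Y × length Y ≡ m
  extend-to m X uX X⊆[n] F#X |X|≤m bound
    with extend-by (m ∸ length X) X uX X⊆[n] F#X
           (subst (λ t → length F + t ≤ n) (sym (m+[n∸m]≡n |X|≤m)) bound)
  ... | Y , uY , Y⊆[n] , F#Y , X⊆Y , |Y| = Y , uY , Y⊆[n] , F#Y , X⊆Y , trans |Y| (m+[n∸m]≡n |X|≤m)

Within : ℕ → (ℕ → Set) → ℕ → Set
Within N P w = InRange N w × P w

Reach-mono : ∀ {G S T u v} → (∀ {w} → S w → T w) → Reach G S u v → Reach G T u v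
Reach-mono S⇒T here         = here
Reach-mono S⇒T (step a s r) = step a (S⇒T s) (Reach-mono S⇒T r)

module _ (G : Graph) {n : ℕ} (peo : IsPEO G n) (P : ℕ → Set) where

  private
    top : ∀ {μ w} → InRange (suc μ) w → ¬ w ≤ μ → w ≡ suc μ
    top (_ , w≤1+μ) w≰μ = ≤-antisym w≤1+μ (≰⇒> w≰μ)

  mutual
    Reach-dropTop : ∀ {μ u v} → suc μ ≤ n → InRange μ u → InRange μ v →
                    Reach G (Within (suc μ) P) u v → Reach G (Within μ P) u v
    Reach-dropTop le ru rv here = here
    Reach-dropTop {μ} le ru rv (step {w = w} a (w∈ , pw) r) with w ≤? μ
    ... | yes w≤μ = step a ((proj₁ w∈ , w≤μ) , pw) (Reach-dropTop le (proj₁ w∈ , w≤μ) rv r)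
    ... | no w≰μ with refl ← top w∈ w≰μ = Reach-bypassTop le ru rv a r

    Reach-bypassTop : ∀ {μ u v} → suc μ ≤ n → InRange μ u → InRange μ v → Adj G u (suc μ) →
                      Reach G (Within (suc μ) P) (suc μ) v → Reach G (Within μ P) u v
    Reach-bypassTop le ru rv a here = ⊥-elim (1+n≰n (proj₂ rv))
    Reach-bypassTop {μ} {u} le ru rv a (step {w = w} a′ (w∈ , pw) r) with w ≤? μ
    ... | no w≰μ = ⊥-elim (irrefl G (subst (Adj G (suc μ)) (top w∈ w≰μ) a′))
    ... | yes w≤μ with u ≟ w
    ...   | yes refl = Reach-dropTop le ru rv r
    ...   | no u≢w =
      step (peo (suc μ) u w (s≤s z≤n , le) (s≤s (proj₂ ru)) (s≤s w≤μ) (symm G a) a′ u≢w)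
           ((proj₁ w∈ , w≤μ) , pw)
           (Reach-dropTop le (proj₁ w∈ , w≤μ) rv r)

  Reach-dropTops : ∀ d {ν u v} → d + ν ≤ n → InRange ν u → InRange ν v →
                   Reach G (Within (d + ν) P) u v → Reach G (Within ν P) u v
  Reach-dropTops zero    _  _  _  r = r
  Reach-dropTops (suc d) {ν} le ru rv r =
    Reach-dropTops d (≤-trans (n≤1+n _) le) ru rv (Reach-dropTop le (widen ru) (widen rv) r)
    where
    widen : ∀ {w} → InRange ν w → InRange (d + ν) w
    widen (1≤w , w≤ν) = 1≤w , ≤-trans w≤ν (m≤n+m ν d)

  Reach-restrict : ∀ {ν u v} → ν ≤ n → InRange ν u → InRange ν v →
                   Reach G (Within n P) u v → Reach G (Within ν P) u v
  Reach-restrict {ν} ν≤n ru rv r =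
    Reach-dropTops (n ∸ ν) (≤-reflexive split) ru rv
      (subst (λ N → Reach G (Within N P) _ _) (sym split) r)
    where
    split : n ∸ ν + ν ≡ n
    split = m∸n+n≡m ν≤n

InRange-mono : ∀ {ν n w} → ν ≤ n → InRange ν w → InRange n w
InRange-mono ν≤n (1≤w , w≤ν) = 1≤w , ≤-trans w≤ν ν≤n

Connected-prefix : ∀ {G n k ν} → IsPEO G n → KConnected G n (suc k) → ν ≤ n →
                   (X : List ℕ) → Unique X → length X ≤ k → All (InRange ν) X →
                   Connected G (λ v → InRange ν v × v ∉ X)
Connected-prefix {G} {n} {k} peo (k+2≤n , conn) ν≤n X uX |X|≤k X⊆[ν] u v (ru , u∉X) (rv , v∉X)
  with extend-to (u ∷ v ∷ []) k X uX (All.map (InRange-mono ν≤n) X⊆[ν]) uv#X |X|≤k k+2≤n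
  where
  uv#X : Disjoint (u ∷ v ∷ []) X
  uv#X (here refl , u∈X)         = u∉X u∈X
  uv#X (there (here refl) , v∈X) = v∉X v∈X
... | Y , uY , Y⊆[n] , uv#Y , X⊆Y , |Y| =
  Reach-restrict G peo (_∉ X) ν≤n ru rv
    (Reach-mono (λ (w∈ , w∉Y) → w∈ , λ w∈X → w∉Y (X⊆Y w∈X))
      (conn Y uY |Y| Y⊆[n] u v (InRange-mono ν≤n ru , λ u∈Y → uv#Y (here refl , u∈Y))
                               (InRange-mono ν≤n rv , λ v∈Y → uv#Y (there (here refl) , v∈Y))))

lemma34 : (n k : ℕ) (G : Graph) → 1 ≤ k → IsPEO G n → KConnected G n k →
    (ν : ℕ) → 2 ≤ ν → ν ≤ n → KConnected G ν ((ν ∸ 1) ⊓ k)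
lemma34 n (suc k) G (s≤s z≤n) peo kconn (suc (suc ν)) (s≤s (s≤s z≤n)) ν≤n =
  s≤s (m⊓n≤m (suc ν) (suc k)) ,
  λ X uX |X| X⊆[ν] → Connected-prefix peo kconn ν≤n X uX (removable |X|) X⊆[ν]
  where
  removable : ∀ {m} → m ≡ suc ν ⊓ suc k ∸ 1 → m ≤ k
  removable refl = ∸-monoˡ-≤ 1 (m⊓n≤n (suc ν) (suc k))
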